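{- Let $\Sigma=\{0\}$ and let $\varphi$ be a first-order formula over the signature $\{P_0\}$ with linear order and the addition predicate, with free variables $x$ and $\bar y=y_1,\dots,y_k$. Then there are $l,m\ge 1$ such that for every $n$ and every choice of $y_1,\dots,y_k\in\{1,\dots,n\}$, the string $t_\varphi^{\bar y}(0^n)$ is $(l,m)$-bounded.
   Context: Words $w$ of length $n$ are structures with universe $\{1,\dots,n\}$, letter predicate $P_0$, linear order $<$, equality, constants min, max, and the ternary predicate $x+y=z$ (with its obvious meaning); this logic is denoted $\mathrm{FO}(+)$. For a formula $\varphi$ with free variables $x,\bar y$, a word $w$ and values of $\bar y$, $t_\varphi^{\bar y}(w)$ is the $0$-$1$ string $v_1\cdots v_{|w|}$ with $v_i=1$ iff $\langle w,i,\bar y\rangle\models\varphi$ (i.e. $\varphi$ holds in $w$ with $x=i$). A string is $(l,m)$-bounded if it lies in $u_1^*u_2^*\cdots u_l^*$ for some strings $u_1,\dots,u_l$ each of length at most $m$. -}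

module Defs where

open import Data.Nat using (ℕ; zero; suc; _+_; _≤_; _<ᵇ_; _≡ᵇ_)
open import Data.Bool using (Bool; true; false; not; _∧_; _∨_)
open import Data.Fin using (Fin; zero; suc)
open import Data.List using (List; []; _∷_; map; upTo; length; concat; replicate)
open import Data.Bool.ListAction using (any; all)
open import Data.Vec using (Vec; toList; zipWith)
open import Data.Vec.Relation.Unary.All using (All)
open import Data.Product using (∃; _×_)
open import Relation.Binary.PropositionalEquality using (_≡_)

data Letter : Set where
  𝟘 : Letter

Word : Set
Word = List Letter

-- letter at 1-based position i (false if out of range)
isP₀ : Word → ℕ → Bool
isP₀ []      _             = false
isP₀ (_ ∷ w) zero          = false
isP₀ (𝟘 ∷ w) (suc zero)    = true
isP₀ (_ ∷ w) (suc (suc i)) = isP₀ w (suc i)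

data Term (v : ℕ) : Set where
  var  : Fin v → Term v
  tmin : Term v
  tmax : Term v

data Formula (v : ℕ) : Set where
  P₀    : Term v → Formula v
  _≺_   : Term v → Term v → Formula v
  _≐_   : Term v → Term v → Formula v
  plus  : Term v → Term v → Term v → Formula v   -- plus a b c  means  a + b = c
  ¬'_   : Formula v → Formula v
  _∧'_  : Formula v → Formula v → Formula v
  _∨'_  : Formula v → Formula v → Formula v
  ∃'_   : Formula (suc v) → Formula v
  ∀'_   : Formula (suc v) → Formula v

positions : ℕ → List ℕ
positions n = map suc (upTo n)

extend : ∀ {v} → ℕ → (Fin v → ℕ) → Fin (suc v) → ℕ
extend a ρ zero    = a
extend a ρ (suc j) = ρ j

evalTerm : ∀ {v} → Word → (Fin v → ℕ) → Term v → ℕ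
evalTerm w ρ (var j) = ρ j
evalTerm w ρ tmin    = 1
evalTerm w ρ tmax    = length w

sat : ∀ {v} → Word → Formula v → (Fin v → ℕ) → Bool
sat w (P₀ t)       ρ = isP₀ w (evalTerm w ρ t)
sat w (a ≺ b)      ρ = evalTerm w ρ a <ᵇ evalTerm w ρ b
sat w (a ≐ b)      ρ = evalTerm w ρ a ≡ᵇ evalTerm w ρ b
sat w (plus a b c) ρ = (evalTerm w ρ a + evalTerm w ρ b) ≡ᵇ evalTerm w ρ c
sat w (¬' φ)       ρ = not (sat w φ ρ)
sat w (φ ∧' ψ)     ρ = sat w φ ρ ∧ sat w ψ ρ
sat w (φ ∨' ψ)     ρ = sat w φ ρ ∨ sat w ψ ρ
sat w (∃' φ)       ρ = any (λ i → sat w φ (extend i ρ)) (positions (length w))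
sat w (∀' φ)       ρ = all (λ i → sat w φ (extend i ρ)) (positions (length w))

-- t_φ^ȳ(w) = v₁⋯v_{|w|} with vᵢ = 1 iff ⟨w,i,ȳ⟩ ⊨ φ ; free variable 0 is x, 1+j is y_{j+1}
tString : ∀ {k} → Formula (suc k) → Word → (Fin k → ℕ) → List Bool
tString φ w ys = map (λ i → sat w φ (extend i ys)) (positions (length w))

pow : List Bool → ℕ → List Bool
pow u e = concat (replicate e u)

Bounded : ℕ → ℕ → List Bool → Set
Bounded l m s =
  ∃ λ (us : Vec (List Bool) l) → ∃ λ (es : Vec ℕ l) →
    All (λ u → length u ≤ m) us × s ≡ concat (toList (zipWith pow us es))

module Submission where

-- On the unary word 0ⁿ an FO(+) formula only speaks about positions, so it is a Presburger
-- formula with the length n as an extra parameter. Eliminating the bounded quantifiers with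
-- Cooper's method turns φ(x, ȳ) into a Boolean combination of atoms a·x + t > 0 and d ∣ a·x + t,
-- where t does not involve x. An inequality atom is monotone in x, so it changes value at most
-- once; a divisibility atom is periodic with period M, the product of all divisors. Hence, on
-- [1, n], x ↦ φ(x, ȳ) cuts into at most 2^(N+1) pieces (N the number of atoms), each M-periodic
-- and so of the form u^e v with |u|, |v| ≤ M. Neither N nor M depends on n or ȳ.

open import Data.Bool as Bool using (Bool; true; false; not; _∧_; _∨_; T; if_then_else_)
open import Data.Bool.ListAction using (any; all; or)
open import Data.Bool.Properties using (T-∧; T-∨; T-≡; ¬-not; if-float; not-involutive; ∨-∧-booleanAlgebra)
open import Algebra.Lattice.Properties.BooleanAlgebra ∨-∧-booleanAlgebra using (deMorgan₁; deMorgan₂)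
open import Data.Empty using (⊥-elim)
open import Data.Fin using (Fin; zero; suc; inject₁; fromℕ)
open import Data.Integer as ℤ using (ℤ; +_; +[1+_]; -[1+_]; 0ℤ; 1ℤ; -1ℤ; _+_; _*_; -_; _-_; _⊖_)
open import Data.Integer.Divisibility.Signed
  using (_∣_; _∣?_; divides; ∣ᵤ⇒∣; ∣m+n∣n⇒∣m; ∣m∣n⇒∣m+n; ∣n⇒∣m*n; ∣m⇒∣-m; *-cancelˡ-∣; *-monoʳ-∣)
import Data.Integer.Properties as ℤ
open import Data.Integer.Tactic.RingSolver using (solve-∀)
open import Data.List as List using (List; []; _∷_; _++_; replicate; upTo; length; concat)
open import Data.List.Membership.Propositional using (_∈_; find; lose)
open import Data.List.Membership.Propositional.Properties using (∈-++⁺ˡ; ∈-++⁺ʳ; ∈-map⁺; ∈-upTo⁺; ∈-upTo⁻)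
open import Data.List.Properties using (length-replicate; map-cong; map-∘; map-upTo; concat-++; ++-identityʳ)
open import Data.List.Relation.Unary.All as All using (All)
import Data.List.Relation.Unary.All.Properties as All
open import Data.List.Relation.Unary.Any as Any using (Any; here; there; satisfied)
open import Data.List.Relation.Unary.Any.Properties using (map⁺; map⁻; concatMap⁺; applyUpTo⁺; any⁺; any⁻)
open import Data.Nat as ℕ using (ℕ; zero; suc; _≤_; NonZero)
open import Data.Nat.Divisibility using (∣⇒≤) renaming (_∣_ to _∣ℕ_)
import Data.Nat.DivMod as ℕ
open import Data.Nat.Induction using (<-rec)
open import Data.Nat.ListAction using (product)
open import Data.Nat.ListAction.Properties using (∈⇒∣product; product≢0)
import Data.Nat.Properties as ℕ
open import Data.Product using (∃; ∃₂; _×_; _,_)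
open import Data.Sum as Sum using (inj₁; inj₂)
open import Data.Unit using (⊤)
open import Data.Vec as Vec using (Vec; []; _∷_; lookup; toList; zipWith)
import Data.Vec.Properties as Vec
import Data.Vec.Relation.Unary.All as AllV
import Data.Vec.Relation.Unary.All.Properties as AllV
open import Function using (_∘_; _⇔_; mk⇔; Equivalence)
open import Relation.Binary.PropositionalEquality
  using (_≡_; refl; sym; trans; cong; cong₂; subst; module ≡-Reasoning)
open import Relation.Nullary using (¬_)
open import Relation.Nullary.Decidable
  using (Dec; yes; no; does; _because_; does-⇔; dec-true; dec-false; T?)

open import Defs

private variable
  v : ℕ
  A B : Set

does⇒ : ∀ {P : Set} (p? : Dec P) → T (does p?) → P
does⇒ (yes p) _ = p

⇒does : ∀ {P : Set} (p? : Dec P) → P → T (does p?)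
⇒does (yes _) _ = _
⇒does (no ¬p) p = ¬p p

T-⇔⇒≡ : ∀ {a b} → T a ⇔ T b → a ≡ b
T-⇔⇒≡ {a} {b} a⇔b = does-⇔ a⇔b (T? a) (T? b)

infixr 6 _x+_
data LinForm : ℕ → Set where
  con  : ℤ → LinForm zero
  _x+_ : ℤ → LinForm v → LinForm (suc v)

⟦_⟧ˡ : LinForm v → Vec ℤ v → ℤ
⟦ con c ⟧ˡ  []      = c
⟦ a x+ l ⟧ˡ (z ∷ ρ) = a * z + ⟦ l ⟧ˡ ρ

infixl 6 _+ˡ_ _-ˡ_
infixl 7 _*ˡ_

_+ˡ_ : LinForm v → LinForm v → LinForm v
con c    +ˡ con d    = con (c + d)
(a x+ l) +ˡ (b x+ m) = (a + b) x+ (l +ˡ m)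

_*ˡ_ : ℤ → LinForm v → LinForm v
k *ˡ con c    = con (k * c)
k *ˡ (a x+ l) = (k * a) x+ (k *ˡ l)

_-ˡ_ : LinForm v → LinForm v → LinForm v
l -ˡ m = l +ˡ -1ℤ *ˡ m

constˡ : ℤ → LinForm v
constˡ {zero}  c = con c
constˡ {suc v} c = 0ℤ x+ constˡ c

sucˡ : LinForm v → LinForm v
sucˡ t = constˡ 1ℤ +ˡ t

varˡ : Fin v → LinForm v
varˡ zero    = 1ℤ x+ constˡ 0ℤ
varˡ (suc j) = 0ℤ x+ varˡ j

_[_]ˡ : LinForm (suc v) → LinForm v → LinForm v
(a x+ l) [ b ]ˡ = a *ˡ b +ˡ l

⟦+ˡ⟧ : ∀ (l m : LinForm v) ρ → ⟦ l +ˡ m ⟧ˡ ρ ≡ ⟦ l ⟧ˡ ρ + ⟦ m ⟧ˡ ρ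
⟦+ˡ⟧ (con c)  (con d)  []      = refl
⟦+ˡ⟧ (a x+ l) (b x+ m) (z ∷ ρ) rewrite ⟦+ˡ⟧ l m ρ = ring a b z (⟦ l ⟧ˡ ρ) (⟦ m ⟧ˡ ρ)
  where
  ring : ∀ a b z x y → (a + b) * z + (x + y) ≡ a * z + x + (b * z + y)
  ring = solve-∀

⟦*ˡ⟧ : ∀ k (l : LinForm v) ρ → ⟦ k *ˡ l ⟧ˡ ρ ≡ k * ⟦ l ⟧ˡ ρ
⟦*ˡ⟧ k (con c)  []      = refl
⟦*ˡ⟧ k (a x+ l) (z ∷ ρ) rewrite ⟦*ˡ⟧ k l ρ = ring k a z (⟦ l ⟧ˡ ρ)
  where
  ring : ∀ k a z x → k * a * z + k * x ≡ k * (a * z + x)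
  ring = solve-∀

⟦-ˡ⟧ : ∀ (l m : LinForm v) ρ → ⟦ l -ˡ m ⟧ˡ ρ ≡ ⟦ l ⟧ˡ ρ - ⟦ m ⟧ˡ ρ
⟦-ˡ⟧ l m ρ rewrite ⟦+ˡ⟧ l (-1ℤ *ˡ m) ρ | ⟦*ˡ⟧ -1ℤ m ρ = ring (⟦ l ⟧ˡ ρ) (⟦ m ⟧ˡ ρ)
  where
  ring : ∀ x y → x + -1ℤ * y ≡ x - y
  ring = solve-∀

⟦constˡ⟧ : ∀ c (ρ : Vec ℤ v) → ⟦ constˡ c ⟧ˡ ρ ≡ c
⟦constˡ⟧ c []      = refl
⟦constˡ⟧ c (z ∷ ρ) rewrite ⟦constˡ⟧ c ρ = ring z c
  where
  ring : ∀ z c → 0ℤ * z + c ≡ c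
  ring = solve-∀

⟦varˡ⟧ : ∀ (j : Fin v) ρ → ⟦ varˡ j ⟧ˡ ρ ≡ lookup ρ j
⟦varˡ⟧ zero    (z ∷ ρ) rewrite ⟦constˡ⟧ 0ℤ ρ = ring z
  where
  ring : ∀ z → 1ℤ * z + 0ℤ ≡ z
  ring = solve-∀
⟦varˡ⟧ (suc j) (z ∷ ρ) rewrite ⟦varˡ⟧ j ρ = ring z (lookup ρ j)
  where
  ring : ∀ z x → 0ℤ * z + x ≡ x
  ring = solve-∀

⟦[]ˡ⟧ : ∀ (l : LinForm (suc v)) b ρ → ⟦ l [ b ]ˡ ⟧ˡ ρ ≡ ⟦ l ⟧ˡ (⟦ b ⟧ˡ ρ ∷ ρ)
⟦[]ˡ⟧ (a x+ l) b ρ rewrite ⟦+ˡ⟧ (a *ˡ b) l ρ | ⟦*ˡ⟧ a b ρ = refl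

⟦sucˡ⟧ : ∀ (t : LinForm v) ρ {n} → ⟦ t ⟧ˡ ρ ≡ + n → ⟦ sucˡ t ⟧ˡ ρ ≡ + suc n
⟦sucˡ⟧ t ρ t≡n = trans (⟦+ˡ⟧ (constˡ 1ℤ) t ρ) (cong₂ _+_ (⟦constˡ⟧ 1ℤ ρ) t≡n)

infixr 7 _∧ᶜ_
infixr 6 _∨ᶜ_
data BoolComb (A : Set) : Set where
  atom      : A → BoolComb A
  _∧ᶜ_ _∨ᶜ_ : BoolComb A → BoolComb A → BoolComb A

evalᶜ : (A → Bool) → BoolComb A → Bool
evalᶜ f (atom α) = f α
evalᶜ f (p ∧ᶜ q) = evalᶜ f p ∧ evalᶜ f q
evalᶜ f (p ∨ᶜ q) = evalᶜ f p ∨ evalᶜ f q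

mapᶜ : (A → B) → BoolComb A → BoolComb B
mapᶜ g (atom α) = atom (g α)
mapᶜ g (p ∧ᶜ q) = mapᶜ g p ∧ᶜ mapᶜ g q
mapᶜ g (p ∨ᶜ q) = mapᶜ g p ∨ᶜ mapᶜ g q

dualᶜ : (A → A) → BoolComb A → BoolComb A
dualᶜ neg (atom α) = atom (neg α)
dualᶜ neg (p ∧ᶜ q) = dualᶜ neg p ∨ᶜ dualᶜ neg q
dualᶜ neg (p ∨ᶜ q) = dualᶜ neg p ∧ᶜ dualᶜ neg q

atoms : BoolComb A → List A
atoms (atom α) = α ∷ []
atoms (p ∧ᶜ q) = atoms p ++ atoms q
atoms (p ∨ᶜ q) = atoms p ++ atoms q

evalᶜ-map : ∀ {f : B → Bool} {g : A → B} {h : A → Bool} q →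
            (∀ {α} → α ∈ atoms q → f (g α) ≡ h α) → evalᶜ f (mapᶜ g q) ≡ evalᶜ h q
evalᶜ-map (atom α) eq = eq (here refl)
evalᶜ-map (p ∧ᶜ q) eq = cong₂ _∧_ (evalᶜ-map p (eq ∘ ∈-++⁺ˡ)) (evalᶜ-map q (eq ∘ ∈-++⁺ʳ _))
evalᶜ-map (p ∨ᶜ q) eq = cong₂ _∨_ (evalᶜ-map p (eq ∘ ∈-++⁺ˡ)) (evalᶜ-map q (eq ∘ ∈-++⁺ʳ _))

evalᶜ-dual : ∀ {f : A → Bool} {neg} → (∀ α → f (neg α) ≡ not (f α)) →
             ∀ q → evalᶜ f (dualᶜ neg q) ≡ not (evalᶜ f q)
evalᶜ-dual eq (atom α) = eq α
evalᶜ-dual {f = f} eq (p ∧ᶜ q) rewrite evalᶜ-dual eq p | evalᶜ-dual eq q =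
  sym (deMorgan₁ (evalᶜ f p) (evalᶜ f q))
evalᶜ-dual {f = f} eq (p ∨ᶜ q) rewrite evalᶜ-dual eq p | evalᶜ-dual eq q =
  sym (deMorgan₂ (evalᶜ f p) (evalᶜ f q))

evalᶜ-mono : ∀ {f g : A → Bool} q → (∀ {α} → α ∈ atoms q → T (f α) → T (g α)) →
             T (evalᶜ f q) → T (evalᶜ g q)
evalᶜ-mono (atom α) imp = imp (here refl)
evalᶜ-mono (p ∧ᶜ q) imp t with Equivalence.to T-∧ t
... | tp , tq = Equivalence.from T-∧ (evalᶜ-mono p (imp ∘ ∈-++⁺ˡ) tp , evalᶜ-mono q (imp ∘ ∈-++⁺ʳ _) tq)
evalᶜ-mono (p ∨ᶜ q) imp t = Equivalence.from T-∨
  (Sum.map (evalᶜ-mono p (imp ∘ ∈-++⁺ˡ)) (evalᶜ-mono q (imp ∘ ∈-++⁺ʳ _)) (Equivalence.to T-∨ t))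

-- Quantifier-free Presburger formulas

data Atom (v : ℕ) : Set where
  pos      : LinForm v → Atom v
  dvd ndvd : (d : ℕ) {{_ : NonZero d}} → LinForm v → Atom v

⟦_⟧ᵃ : Atom v → Vec ℤ v → Bool
⟦ pos t ⟧ᵃ    ρ = does (0ℤ ℤ.<? ⟦ t ⟧ˡ ρ)
⟦ dvd d t ⟧ᵃ  ρ = does (+ d ∣? ⟦ t ⟧ˡ ρ)
⟦ ndvd d t ⟧ᵃ ρ = not (does (+ d ∣? ⟦ t ⟧ˡ ρ))

QF : ℕ → Set
QF v = BoolComb (Atom v)

⟦_⟧ : QF v → Vec ℤ v → Bool
⟦ q ⟧ ρ = evalᶜ (λ α → ⟦ α ⟧ᵃ ρ) q

negᵃ : Atom v → Atom v
negᵃ (pos t)    = pos (constˡ 1ℤ -ˡ t)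
negᵃ (dvd d t)  = ndvd d t
negᵃ (ndvd d t) = dvd d t

¬ᶠ_ : QF v → QF v
¬ᶠ_ = dualᶜ negᵃ

0<1-x≡¬0<x : ∀ x → does (0ℤ ℤ.<? 1ℤ - x) ≡ not (does (0ℤ ℤ.<? x))
0<1-x≡¬0<x (+ zero)         = refl
0<1-x≡¬0<x +[1+ zero ]      = refl
0<1-x≡¬0<x +[1+ suc m ]     = refl
0<1-x≡¬0<x -[1+ m ]         = refl

⟦negᵃ⟧ : ∀ (α : Atom v) ρ → ⟦ negᵃ α ⟧ᵃ ρ ≡ not (⟦ α ⟧ᵃ ρ)
⟦negᵃ⟧ (pos t) ρ rewrite ⟦-ˡ⟧ (constˡ 1ℤ) t ρ | ⟦constˡ⟧ 1ℤ ρ = 0<1-x≡¬0<x (⟦ t ⟧ˡ ρ)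
⟦negᵃ⟧ (dvd d t)  ρ = refl
⟦negᵃ⟧ (ndvd d t) ρ = sym (not-involutive _)

⟦¬ᶠ⟧ : ∀ (q : QF v) ρ → ⟦ ¬ᶠ q ⟧ ρ ≡ not (⟦ q ⟧ ρ)
⟦¬ᶠ⟧ q ρ = evalᶜ-dual (λ α → ⟦negᵃ⟧ α ρ) q

_[_]ᵃ : Atom (suc v) → LinForm v → Atom v
pos t    [ b ]ᵃ = pos (t [ b ]ˡ)
dvd d t  [ b ]ᵃ = dvd d (t [ b ]ˡ)
ndvd d t [ b ]ᵃ = ndvd d (t [ b ]ˡ)

_[_] : QF (suc v) → LinForm v → QF v
q [ b ] = mapᶜ _[ b ]ᵃ q

⟦[]ᵃ⟧ : ∀ (α : Atom (suc v)) b ρ → ⟦ α [ b ]ᵃ ⟧ᵃ ρ ≡ ⟦ α ⟧ᵃ (⟦ b ⟧ˡ ρ ∷ ρ)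
⟦[]ᵃ⟧ (pos t)    b ρ rewrite ⟦[]ˡ⟧ t b ρ = refl
⟦[]ᵃ⟧ (dvd d t)  b ρ rewrite ⟦[]ˡ⟧ t b ρ = refl
⟦[]ᵃ⟧ (ndvd d t) b ρ rewrite ⟦[]ˡ⟧ t b ρ = refl

⟦[]⟧ : ∀ (q : QF (suc v)) b ρ → ⟦ q [ b ] ⟧ ρ ≡ ⟦ q ⟧ (⟦ b ⟧ˡ ρ ∷ ρ)
⟦[]⟧ q b ρ = evalᶜ-map q (λ {α} _ → ⟦[]ᵃ⟧ α b ρ)

⊥ᶠ : QF v
⊥ᶠ = atom (pos (constˡ 0ℤ))

⋁ : List (QF v) → QF v
⋁ []       = ⊥ᶠ
⋁ (q ∷ qs) = q ∨ᶜ ⋁ qs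

⋁⁺ : ∀ {qs : List (QF v)} {ρ} → Any (λ q → T (⟦ q ⟧ ρ)) qs → T (⟦ ⋁ qs ⟧ ρ)
⋁⁺ (here t)   = Equivalence.from T-∨ (inj₁ t)
⋁⁺ (there ts) = Equivalence.from T-∨ (inj₂ (⋁⁺ ts))

⋁⁻ : ∀ (qs : List (QF v)) {ρ} → T (⟦ ⋁ qs ⟧ ρ) → Any (λ q → T (⟦ q ⟧ ρ)) qs
⋁⁻ [] {ρ} t rewrite ⟦constˡ⟧ 0ℤ ρ = ⊥-elim t
⋁⁻ (q ∷ qs) t with Equivalence.to T-∨ t
... | inj₁ tq  = here tq
... | inj₂ tqs = there (⋁⁻ qs tqs)

-- Cooper's elimination of the innermost variable

-- Only a positive coefficient of the eliminated variable must be 1: those atoms are the lower bounds.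
HeadAtMostOne : Atom (suc v) → Set
HeadAtMostOne (pos (a x+ t)) = a ℤ.≤ 1ℤ
HeadAtMostOne (dvd _ _)      = ⊤
HeadAtMostOne (ndvd _ _)     = ⊤

divisor : Atom v → ℕ
divisor (pos _)    = 1
divisor (dvd d _)  = d
divisor (ndvd d _) = d

divisor-nonZero : (α : Atom v) → NonZero (divisor α)
divisor-nonZero (pos _)           = _
divisor-nonZero (dvd d {{d≢0}} _)  = d≢0
divisor-nonZero (ndvd d {{d≢0}} _) = d≢0

period : QF v → ℕ
period q = product (List.map divisor (atoms q))

period-nonZero : (q : QF v) → NonZero (period q)
period-nonZero q = product≢0 (All.map⁺ (All.universal divisor-nonZero (atoms q)))

divisor∣period : ∀ {α} (q : QF v) → α ∈ atoms q → divisor α ∣ℕ period q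
divisor∣period q α∈q = ∈⇒∣product (∈-map⁺ divisor α∈q)

lowerBound : Atom (suc v) → List (LinForm v)
lowerBound (pos (+ 1 x+ t)) = -1ℤ *ˡ t ∷ []
lowerBound _                = []

lowerBounds : QF (suc v) → List (LinForm v)
lowerBounds q = List.concatMap lowerBound (atoms q)

lowerBound⊆lowerBounds : ∀ {P : LinForm v → Set} {α} (q : QF (suc v)) → α ∈ atoms q →
                         Any P (lowerBound α) → Any P (lowerBounds q)
lowerBound⊆lowerBounds q α∈q p = concatMap⁺ lowerBound (Any.map (λ { refl → p }) α∈q)

above : ℕ → LinForm v → List (LinForm v)
above D b = List.applyUpTo (λ j → b +ˡ constˡ (+ suc j)) D

witnesses : ℕ → QF (suc v) → List (LinForm v)
witnesses D q = List.concatMap (above D) (constˡ 0ℤ ∷ lowerBounds q)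

cooper : QF (suc v) → QF v
cooper q = ⋁ (List.map (q [_]) (witnesses (period q) q))

Near : ℕ → Vec ℤ v → ℤ → LinForm v → Set
Near D ρ z b = ∃ λ j → j ℕ.< D × z ≡ ⟦ b ⟧ˡ ρ + + suc j

near⇒witness : ∀ {D ρ z} (bs : List (LinForm v)) → Any (Near D ρ z) bs →
               Any (λ w → z ≡ ⟦ w ⟧ˡ ρ) (List.concatMap (above D) bs)
near⇒witness {D = D} {ρ} bs near = concatMap⁺ (above D) (Any.map witness near)
  where
  witness : ∀ {D z b} → Near D ρ z b → Any (λ w → z ≡ ⟦ w ⟧ˡ ρ) (above D b)
  witness {b = b} (j , j<D , z≡b+j) = applyUpTo⁺ _
    (trans z≡b+j (sym (trans (⟦+ˡ⟧ b (constˡ (+ suc j)) ρ) (cong (_+_ (⟦ b ⟧ˡ ρ)) (⟦constˡ⟧ (+ suc j) ρ)))))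
    j<D

cooper-sound : ∀ (q : QF (suc v)) {ρ} → T (⟦ cooper q ⟧ ρ) → ∃ λ z → T (⟦ q ⟧ (z ∷ ρ))
cooper-sound q {ρ} t with satisfied (map⁻ (⋁⁻ (List.map (q [_]) (witnesses (period q) q)) t))
... | w , tw = ⟦ w ⟧ˡ ρ , subst T (⟦[]⟧ q w ρ) tw

witness⇒cooper : ∀ (q : QF (suc v)) {ρ z} → Any (λ w → z ≡ ⟦ w ⟧ˡ ρ) (witnesses (period q) q) →
                 T (⟦ q ⟧ (z ∷ ρ)) → T (⟦ cooper q ⟧ ρ)
witness⇒cooper q {ρ} hit t = ⋁⁺ (map⁺ (Any.map (λ { {w} refl → subst T (sym (⟦[]⟧ q w ρ)) t }) hit))

∣-periodic : ∀ (d a b : ℤ) {y} → d ∣ y → ∀ z → d ∣ a * (z + y) + b ⇔ d ∣ a * z + b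
∣-periodic d a b {y} d∣y z = mk⇔
  (λ d∣lhs → ∣m+n∣n⇒∣m (subst (d ∣_) shift d∣lhs) d∣ay)
  (λ d∣rhs → subst (d ∣_) (sym shift) (∣m∣n⇒∣m+n d∣rhs d∣ay))
  where
  d∣ay : d ∣ a * y
  d∣ay = ∣n⇒∣m*n a d∣y
  shift : a * (z + y) + b ≡ (a * z + b) + a * y
  shift = ring a z y b
    where
    ring : ∀ a z y b → a * (z + y) + b ≡ (a * z + b) + a * y
    ring = solve-∀

dvd-periodic : ∀ d (a b : ℤ) {y} → + d ∣ y → ∀ z →
               does (+ d ∣? a * (z + y) + b) ≡ does (+ d ∣? a * z + b)
dvd-periodic d a b {y} d∣y z =
  does-⇔ (∣-periodic (+ d) a b d∣y z) (+ d ∣? a * (z + y) + b) (+ d ∣? a * z + b)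

lower-crossing : ∀ D z b → 0ℤ ℤ.< z + b → ¬ (0ℤ ℤ.< z - + D + b) →
                 ∃ λ j → j ℕ.< D × z ≡ - b + + suc j
lower-crossing D z b 0<z+b ¬0<z-D+b with z + b in z+b≡
... | +[1+ j ] = j , ℤ.drop‿+≤+ (ℤ.i-j≤0⇒i≤j (subst (ℤ._≤ 0ℤ) z-D+b≡ (ℤ.≮⇒≥ ¬0<z-D+b))) , z≡
  where
  ring₁ : ∀ z b D → z - D + b ≡ (z + b) - D
  ring₁ = solve-∀
  ring₂ : ∀ z b → z ≡ - b + (z + b)
  ring₂ = solve-∀
  z-D+b≡ : z - + D + b ≡ +[1+ j ] - + D
  z-D+b≡ = trans (ring₁ z b (+ D)) (cong (_- + D) z+b≡)
  z≡ : z ≡ - b + +[1+ j ]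
  z≡ = trans (ring₂ z b) (cong (_+_ (- b)) z+b≡)
lower-crossing D z b (ℤ.+<+ ()) _ | + zero
lower-crossing D z b ()          _ | -[1+ _ ]

atom-descent : ∀ {D ρ z} (α : Atom (suc v)) → HeadAtMostOne α → divisor α ∣ℕ D →
               ¬ Any (Near D ρ z) (lowerBound α) → T (⟦ α ⟧ᵃ (z ∷ ρ)) → T (⟦ α ⟧ᵃ (z - + D ∷ ρ))
atom-descent (pos (+ 0 x+ t)) _ _ _ holds = holds
atom-descent {D = D} {ρ} {z} (pos (+ 1 x+ t)) _ _ far holds
  with 0ℤ ℤ.<? 1ℤ * (z - + D) + ⟦ t ⟧ˡ ρ
... | yes _  = _
... | no ¬0<
  with lower-crossing D z (⟦ t ⟧ˡ ρ)
         (subst (λ x → 0ℤ ℤ.< x + ⟦ t ⟧ˡ ρ) (ℤ.*-identityˡ z) (does⇒ (0ℤ ℤ.<? _) holds))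
         (¬0< ∘ subst (λ x → 0ℤ ℤ.< x + ⟦ t ⟧ˡ ρ) (sym (ℤ.*-identityˡ (z - + D))))
...   | j , j<D , z≡-b+j = ⊥-elim (far (here (j , j<D , trans z≡-b+j (cong (_+ + suc j) -b≡))))
  where
  -b≡ : - ⟦ t ⟧ˡ ρ ≡ ⟦ -1ℤ *ˡ t ⟧ˡ ρ
  -b≡ = sym (trans (⟦*ˡ⟧ -1ℤ t ρ) (ℤ.-1*i≡-i _))
atom-descent (pos (+[1+ suc _ ] x+ t)) (ℤ.+≤+ (ℕ.s≤s ())) _ _ _
atom-descent {D = D} {ρ} {z} (pos (-[1+ p ] x+ t)) _ _ _ holds =
  ⇒does (0ℤ ℤ.<? _) (subst (0ℤ ℤ.<_) (sym shift)
    (ℤ.+-mono-<-≤ (does⇒ (0ℤ ℤ.<? -[1+ p ] * z + ⟦ t ⟧ˡ ρ) holds) 0≤pD))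
  where
  ring : ∀ p z D b → (- p) * (z - D) + b ≡ ((- p) * z + b) + p * D
  ring = solve-∀
  shift : -[1+ p ] * (z - + D) + ⟦ t ⟧ˡ ρ ≡ (-[1+ p ] * z + ⟦ t ⟧ˡ ρ) + +[1+ p ] * + D
  shift = ring +[1+ p ] z (+ D) (⟦ t ⟧ˡ ρ)
  0≤pD : 0ℤ ℤ.≤ +[1+ p ] * + D
  0≤pD = subst (0ℤ ℤ.≤_) (ℤ.pos-* (suc p) D) (ℤ.+≤+ ℕ.z≤n)
atom-descent {D = D} {ρ} {z} (dvd d (a x+ t)) _ d∣D _ holds =
  subst T (sym (dvd-periodic d a (⟦ t ⟧ˡ ρ) (∣m⇒∣-m (∣ᵤ⇒∣ d∣D)) z)) holds
atom-descent {D = D} {ρ} {z} (ndvd d (a x+ t)) _ d∣D _ holds =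
  subst (T ∘ not) (sym (dvd-periodic d a (⟦ t ⟧ˡ ρ) (∣m⇒∣-m (∣ᵤ⇒∣ d∣D)) z)) holds

cooper-step : ∀ (q : QF (suc v)) {ρ z} → All HeadAtMostOne (atoms q) →
              ¬ Any (Near (period q) ρ z) (lowerBounds q) →
              T (⟦ q ⟧ (z ∷ ρ)) → T (⟦ q ⟧ (z - + period q ∷ ρ))
cooper-step q normal far = evalᶜ-mono q λ {α} α∈q →
  atom-descent α (All.lookup normal α∈q) (divisor∣period q α∈q) (far ∘ lowerBound⊆lowerBounds q α∈q)

+[1+m]-n : ∀ {m n} → n ℕ.≤ m → +[1+ m ] - + n ≡ +[1+ m ℕ.∸ n ]
+[1+m]-n {m} {n} n≤m = begin
  +[1+ m ] - + n      ≡⟨ ℤ.m-n≡m⊖n (suc m) n ⟩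
  suc m ⊖ n           ≡⟨ ℤ.⊖-≥ (ℕ.m≤n⇒m≤1+n n≤m) ⟩
  + (suc m ℕ.∸ n)     ≡⟨ cong +_ (ℕ.+-∸-assoc 1 n≤m) ⟩
  +[1+ m ℕ.∸ n ]      ∎
  where open ≡-Reasoning

-- Descent: a solution that is not a witness can be lowered by D, and it cannot reach 0 without
-- meeting a witness above the lower bound 0.
cooper-complete : ∀ (q : QF (suc v)) {ρ z} → All HeadAtMostOne (atoms q) →
                  0ℤ ℤ.< z → T (⟦ q ⟧ (z ∷ ρ)) → T (⟦ cooper q ⟧ ρ)
cooper-complete q {z = + zero}   _ (ℤ.+<+ ())
cooper-complete q {z = -[1+ _ ]} _ ()
cooper-complete q {ρ} {+[1+ m ]} normal _ = <-rec _ descend m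
  where
  D : ℕ
  D = period q
  descend : ∀ m → (∀ {k} → k ℕ.< m → T (⟦ q ⟧ (+[1+ k ] ∷ ρ)) → T (⟦ cooper q ⟧ ρ)) →
            T (⟦ q ⟧ (+[1+ m ] ∷ ρ)) → T (⟦ cooper q ⟧ ρ)
  descend m rec holds with Any.any? (λ w → +[1+ m ] ℤ.≟ ⟦ w ⟧ˡ ρ) (witnesses D q)
  ... | yes hit = witness⇒cooper q hit holds
  ... | no miss with D ℕ.≤? m
  ...   | no D≰m = ⊥-elim (miss (near⇒witness (constˡ 0ℤ ∷ lowerBounds q) (here (m , ℕ.≰⇒> D≰m , m≡0+m))))
    where
    m≡0+m : +[1+ m ] ≡ ⟦ constˡ 0ℤ ⟧ˡ ρ + +[1+ m ]
    m≡0+m = sym (trans (cong (_+ +[1+ m ]) (⟦constˡ⟧ 0ℤ ρ)) (ℤ.+-identityˡ _))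
  ...   | yes D≤m = rec (ℕ.∸-monoʳ-< (ℕ.>-nonZero⁻¹ D {{period-nonZero q}}) D≤m)
    (subst (λ z → T (⟦ q ⟧ (z ∷ ρ))) (+[1+m]-n D≤m)
      (cooper-step q normal (miss ∘ near⇒witness _ ∘ there) holds))

-- Normalizing coefficients

magnitude : Atom (suc v) → ℕ
magnitude (pos (+[1+ p ] x+ _)) = suc p
magnitude (pos (-[1+ p ] x+ _)) = suc p
magnitude _                     = 1

magnitude-nonZero : (α : Atom (suc v)) → NonZero (magnitude α)
magnitude-nonZero (pos (+ zero x+ _))   = _
magnitude-nonZero (pos (+[1+ _ ] x+ _)) = _
magnitude-nonZero (pos (-[1+ _ ] x+ _)) = _
magnitude-nonZero (dvd _ _)             = _
magnitude-nonZero (ndvd _ _)            = _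

scaleFactor : QF (suc v) → ℕ
scaleFactor q = product (List.map magnitude (atoms q))

scaleFactor-nonZero : (q : QF (suc v)) → NonZero (scaleFactor q)
scaleFactor-nonZero q = product≢0 (All.map⁺ (All.universal magnitude-nonZero (atoms q)))

-- For a common multiple K of the head coefficients, an inequality atom is multiplied by K / |a|, making
-- its head coefficient ±K; then K·z is renamed z′, and `normalize` records K ∣ z′.
scaleᵃ : (K : ℕ) {{_ : NonZero K}} → Atom (suc v) → Atom (suc v)
scaleᵃ K (pos (+ zero x+ t))   = pos (+ zero x+ t)
scaleᵃ K (pos (+[1+ p ] x+ t)) = pos (1ℤ x+ + (K ℕ./ suc p) *ˡ t)
scaleᵃ K (pos (-[1+ p ] x+ t)) = pos (-1ℤ x+ + (K ℕ./ suc p) *ˡ t)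
scaleᵃ K (dvd d (a x+ t))      = dvd (K ℕ.* d) {{ℕ.m*n≢0 K d}} (a x+ + K *ˡ t)
scaleᵃ K (ndvd d (a x+ t))     = ndvd (K ℕ.* d) {{ℕ.m*n≢0 K d}} (a x+ + K *ˡ t)

0<-scale : ∀ m {{_ : NonZero m}} x → does (0ℤ ℤ.<? + m * x) ≡ does (0ℤ ℤ.<? x)
0<-scale (suc m) x = does-⇔ (mk⇔ cancel mono) (0ℤ ℤ.<? +[1+ m ] * x) (0ℤ ℤ.<? x)
  where
  cancel : 0ℤ ℤ.< +[1+ m ] * x → 0ℤ ℤ.< x
  cancel 0<kx = ℤ.*-cancelˡ-<-nonNeg +[1+ m ] (subst (ℤ._< +[1+ m ] * x) (sym (ℤ.*-zeroʳ +[1+ m ])) 0<kx)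
  mono : 0ℤ ℤ.< x → 0ℤ ℤ.< +[1+ m ] * x
  mono 0<x = subst (ℤ._< +[1+ m ] * x) (ℤ.*-zeroʳ +[1+ m ]) (ℤ.*-monoˡ-<-pos +[1+ m ] 0<x)

∣-scale : ∀ k {{_ : NonZero k}} d x → does (+ (k ℕ.* d) ∣? + k * x) ≡ does (+ d ∣? x)
∣-scale k d x = trans (cong (λ kd → does (kd ∣? + k * x)) (ℤ.pos-* k d))
  (does-⇔ (mk⇔ (*-cancelˡ-∣ (+ k)) (*-monoʳ-∣ (+ k))) (+ k * + d ∣? + k * x) (+ d ∣? x))

quotient-nonZero : ∀ {K d} {{_ : NonZero K}} {{_ : NonZero d}} → d ∣ℕ K → NonZero (K ℕ./ d)
quotient-nonZero d∣K = ℕ.>-nonZero (ℕ.m≥n⇒m/n>0 (∣⇒≤ d∣K))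

+K≡+[K/d]*+d : ∀ {K d} {{_ : NonZero d}} → d ∣ℕ K → + K ≡ + (K ℕ./ d) * + d
+K≡+[K/d]*+d {K} {d} d∣K = trans (cong +_ (sym (ℕ.m/n*n≡m d∣K))) (ℤ.pos-* (K ℕ./ d) d)

0<-rescale : ∀ u a m {{_ : NonZero m}} k z (t : LinForm v) ρ → u * k ≡ + m * a →
             does (0ℤ ℤ.<? u * (k * z) + ⟦ + m *ˡ t ⟧ˡ ρ) ≡ does (0ℤ ℤ.<? a * z + ⟦ t ⟧ˡ ρ)
0<-rescale u a m k z t ρ uk≡ma = trans (cong (λ x → does (0ℤ ℤ.<? x)) rescaled) (0<-scale m _)
  where
  open ≡-Reasoning
  ring : ∀ m a z b → m * a * z + m * b ≡ m * (a * z + b)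
  ring = solve-∀
  rescaled : u * (k * z) + ⟦ + m *ˡ t ⟧ˡ ρ ≡ + m * (a * z + ⟦ t ⟧ˡ ρ)
  rescaled = begin
    u * (k * z) + ⟦ + m *ˡ t ⟧ˡ ρ  ≡⟨ cong₂ _+_ (sym (ℤ.*-assoc u k z)) (⟦*ˡ⟧ (+ m) t ρ) ⟩
    u * k * z + + m * ⟦ t ⟧ˡ ρ      ≡⟨ cong (λ c → c * z + + m * ⟦ t ⟧ˡ ρ) uk≡ma ⟩
    + m * a * z + + m * ⟦ t ⟧ˡ ρ    ≡⟨ ring (+ m) a z (⟦ t ⟧ˡ ρ) ⟩
    + m * (a * z + ⟦ t ⟧ˡ ρ)        ∎

⟦x+*ˡ⟧ : ∀ k a z (t : LinForm v) ρ → a * (k * z) + ⟦ k *ˡ t ⟧ˡ ρ ≡ k * (a * z + ⟦ t ⟧ˡ ρ)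
⟦x+*ˡ⟧ k a z t ρ rewrite ⟦*ˡ⟧ k t ρ = ring k a z (⟦ t ⟧ˡ ρ)
  where
  ring : ∀ k a z b → a * (k * z) + k * b ≡ k * (a * z + b)
  ring = solve-∀

⟦scaleᵃ⟧ : ∀ K {{_ : NonZero K}} (α : Atom (suc v)) {ρ} z → magnitude α ∣ℕ K →
           ⟦ scaleᵃ K α ⟧ᵃ (+ K * z ∷ ρ) ≡ ⟦ α ⟧ᵃ (z ∷ ρ)
⟦scaleᵃ⟧ K (pos (+ zero x+ t)) {ρ} z _ =
  cong (λ x → does (0ℤ ℤ.<? x + ⟦ t ⟧ˡ ρ)) (trans (ℤ.*-zeroˡ (+ K * z)) (sym (ℤ.*-zeroˡ z)))
⟦scaleᵃ⟧ K (pos (+[1+ p ] x+ t)) {ρ} z p∣K =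
  0<-rescale 1ℤ +[1+ p ] (K ℕ./ suc p) {{quotient-nonZero p∣K}} (+ K) z t ρ
    (trans (ℤ.*-identityˡ (+ K)) (+K≡+[K/d]*+d p∣K))
⟦scaleᵃ⟧ K (pos (-[1+ p ] x+ t)) {ρ} z p∣K =
  0<-rescale -1ℤ -[1+ p ] (K ℕ./ suc p) {{quotient-nonZero p∣K}} (+ K) z t ρ
    (trans (ℤ.-1*i≡-i (+ K)) (trans (cong -_ (+K≡+[K/d]*+d p∣K)) (ℤ.neg-distribʳ-* (+ (K ℕ./ suc p)) +[1+ p ])))
⟦scaleᵃ⟧ K (dvd d (a x+ t)) {ρ} z _ =
  trans (cong (λ x → does (+ (K ℕ.* d) ∣? x)) (⟦x+*ˡ⟧ (+ K) a z t ρ)) (∣-scale K d _)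
⟦scaleᵃ⟧ K (ndvd d (a x+ t)) {ρ} z _ =
  cong not (trans (cong (λ x → does (+ (K ℕ.* d) ∣? x)) (⟦x+*ˡ⟧ (+ K) a z t ρ)) (∣-scale K d _))

All-atoms-mapᶜ : ∀ {P : B → Set} {g : A → B} → (∀ α → P (g α)) → ∀ q → All P (atoms (mapᶜ g q))
All-atoms-mapᶜ Pg (atom α) = Pg α All.∷ All.[]
All-atoms-mapᶜ Pg (p ∧ᶜ q) = All.++⁺ (All-atoms-mapᶜ Pg p) (All-atoms-mapᶜ Pg q)
All-atoms-mapᶜ Pg (p ∨ᶜ q) = All.++⁺ (All-atoms-mapᶜ Pg p) (All-atoms-mapᶜ Pg q)

scaleᵃ-headAtMostOne : ∀ K {{_ : NonZero K}} (α : Atom (suc v)) → HeadAtMostOne (scaleᵃ K α)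
scaleᵃ-headAtMostOne K (pos (+ zero x+ _))   = ℤ.+≤+ ℕ.z≤n
scaleᵃ-headAtMostOne K (pos (+[1+ _ ] x+ _)) = ℤ.≤-refl
scaleᵃ-headAtMostOne K (pos (-[1+ _ ] x+ _)) = ℤ.-≤+
scaleᵃ-headAtMostOne K (dvd _ (_ x+ _))      = _
scaleᵃ-headAtMostOne K (ndvd _ (_ x+ _))     = _

scale : QF (suc v) → QF (suc v)
scale q = mapᶜ (scaleᵃ (scaleFactor q) {{scaleFactor-nonZero q}}) q

⟦scale⟧ : ∀ (q : QF (suc v)) {ρ} z → ⟦ scale q ⟧ (+ scaleFactor q * z ∷ ρ) ≡ ⟦ q ⟧ (z ∷ ρ)
⟦scale⟧ q z = evalᶜ-map q λ {α} α∈q →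
  ⟦scaleᵃ⟧ (scaleFactor q) {{scaleFactor-nonZero q}} α z (∈⇒∣product (∈-map⁺ magnitude α∈q))

normalize : QF (suc v) → QF (suc v)
normalize q = atom (dvd (scaleFactor q) {{scaleFactor-nonZero q}} (1ℤ x+ constˡ 0ℤ)) ∧ᶜ scale q

normalize-headAtMostOne : (q : QF (suc v)) → All HeadAtMostOne (atoms (normalize q))
normalize-headAtMostOne q = _ All.∷ All-atoms-mapᶜ (scaleᵃ-headAtMostOne _ {{scaleFactor-nonZero q}}) q

⟦1x+0⟧ : ∀ z (ρ : Vec ℤ v) → ⟦ 1ℤ x+ constˡ 0ℤ ⟧ˡ (z ∷ ρ) ≡ z
⟦1x+0⟧ z ρ = trans (cong (_+_ (1ℤ * z)) (⟦constˡ⟧ 0ℤ ρ)) (trans (ℤ.+-identityʳ _) (ℤ.*-identityˡ z))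

normalize⁺ : ∀ (q : QF (suc v)) {ρ} z → T (⟦ q ⟧ (z ∷ ρ)) → T (⟦ normalize q ⟧ (+ scaleFactor q * z ∷ ρ))
normalize⁺ q {ρ} z holds = Equivalence.from T-∧
  ( ⇒does (+ K ∣? _) (divides z (trans (⟦1x+0⟧ (+ K * z) ρ) (ℤ.*-comm (+ K) z)))
  , subst T (sym (⟦scale⟧ q z)) holds )
  where
  K : ℕ
  K = scaleFactor q

normalize⁻ : ∀ (q : QF (suc v)) {ρ} z′ → T (⟦ normalize q ⟧ (z′ ∷ ρ)) → ∃ λ z → T (⟦ q ⟧ (z ∷ ρ))
normalize⁻ q {ρ} z′ holds with Equivalence.to T-∧ holds
... | K∣z′ , scaled with does⇒ (+ scaleFactor q ∣? _) K∣z′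
...   | divides z z′≡zK = z , subst T (⟦scale⟧ q z) (subst (λ x → T (⟦ scale q ⟧ (x ∷ ρ))) z′≡Kz scaled)
  where
  z′≡Kz : z′ ≡ + scaleFactor q * z
  z′≡Kz = trans (sym (⟦1x+0⟧ z′ ρ)) (trans z′≡zK (ℤ.*-comm z _))

-- Bounded quantifiers

0<⊖⇔ : ∀ m n → (0ℤ ℤ.< m ⊖ n) ⇔ (n ℕ.< m)
0<⊖⇔ zero    zero    = mk⇔ (λ { (ℤ.+<+ ()) }) (λ ())
0<⊖⇔ zero    (suc n) = mk⇔ (λ ()) (λ ())
0<⊖⇔ (suc m) zero    = mk⇔ (λ _ → ℕ.z<s) (λ _ → ℤ.+<+ ℕ.z<s)
0<⊖⇔ (suc m) (suc n) rewrite ℤ.[1+m]⊖[1+n]≡m⊖n m n =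
  mk⇔ (ℕ.s<s ∘ Equivalence.to (0<⊖⇔ m n)) (Equivalence.from (0<⊖⇔ m n) ∘ ℕ.s<s⁻¹)

box : LinForm v → QF (suc v) → QF (suc v)
box u q = atom (pos (1ℤ x+ constˡ 0ℤ)) ∧ᶜ atom (pos (-1ℤ x+ sucˡ u)) ∧ᶜ q

⟦-1x+u+1⟧ : ∀ (u : LinForm v) {ρ n} i → ⟦ u ⟧ˡ ρ ≡ + n → ⟦ -1ℤ x+ sucˡ u ⟧ˡ (+ i ∷ ρ) ≡ suc n ⊖ i
⟦-1x+u+1⟧ u {ρ} {n} i u≡n rewrite ⟦sucˡ⟧ u ρ u≡n =
  trans (trans (cong (_+ + suc n) (ℤ.-1*i≡-i (+ i))) (ℤ.+-comm (- + i) (+ suc n))) (ℤ.m-n≡m⊖n (suc n) i)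

box⁺ : ∀ u (q : QF (suc v)) {ρ n i} → ⟦ u ⟧ˡ ρ ≡ + n → 1 ℕ.≤ i → i ℕ.≤ n →
       T (⟦ q ⟧ (+ i ∷ ρ)) → T (⟦ box u q ⟧ (+ i ∷ ρ))
box⁺ u q {ρ} {n} {i} u≡n 1≤i i≤n holds = Equivalence.from T-∧ (lower , Equivalence.from T-∧ (upper , holds))
  where
  lower : T (⟦ pos (1ℤ x+ constˡ 0ℤ) ⟧ᵃ (+ i ∷ ρ))
  lower = ⇒does (0ℤ ℤ.<? _) (subst (0ℤ ℤ.<_) (sym (⟦1x+0⟧ (+ i) ρ)) (ℤ.+<+ 1≤i))
  upper : T (⟦ pos (-1ℤ x+ sucˡ u) ⟧ᵃ (+ i ∷ ρ))
  upper = ⇒does (0ℤ ℤ.<? _) (subst (0ℤ ℤ.<_) (sym (⟦-1x+u+1⟧ u i u≡n))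
            (Equivalence.from (0<⊖⇔ (suc n) i) (ℕ.s≤s i≤n)))

box⁻ : ∀ u (q : QF (suc v)) {ρ n} z → ⟦ u ⟧ˡ ρ ≡ + n → T (⟦ box u q ⟧ (z ∷ ρ)) →
       ∃ λ i → 1 ℕ.≤ i × i ℕ.≤ n × T (⟦ q ⟧ (+ i ∷ ρ))
box⁻ u q {ρ} {n} z u≡n holds with Equivalence.to T-∧ holds
... | lower , rest with Equivalence.to T-∧ rest
...   | upper , holds′ = witness z (subst (0ℤ ℤ.<_) (⟦1x+0⟧ z ρ) (does⇒ (0ℤ ℤ.<? _) lower)) upper holds′
  where
  witness : ∀ z → 0ℤ ℤ.< z → T (⟦ pos (-1ℤ x+ sucˡ u) ⟧ᵃ (z ∷ ρ)) → T (⟦ q ⟧ (z ∷ ρ)) →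
            ∃ λ i → 1 ℕ.≤ i × i ℕ.≤ n × T (⟦ q ⟧ (+ i ∷ ρ))
  witness +[1+ i ] _ upper holds′ = suc i , ℕ.s≤s ℕ.z≤n , ℕ.s≤s⁻¹ i<1+n , holds′
    where
    i<1+n : suc i ℕ.< suc n
    i<1+n = Equivalence.to (0<⊖⇔ (suc n) (suc i))
              (subst (0ℤ ℤ.<_) (⟦-1x+u+1⟧ u (suc i) u≡n) (does⇒ (0ℤ ℤ.<? _) upper))
  witness (+ zero) (ℤ.+<+ ()) _ _

bounded∃ : LinForm v → QF (suc v) → QF v
bounded∃ u q = cooper (normalize (box u q))

bounded∃-sound : ∀ u (q : QF (suc v)) {ρ n} → ⟦ u ⟧ˡ ρ ≡ + n → T (⟦ bounded∃ u q ⟧ ρ) →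
                 ∃ λ i → 1 ℕ.≤ i × i ℕ.≤ n × T (⟦ q ⟧ (+ i ∷ ρ))
bounded∃-sound u q u≡n holds =
  let z′ , normalized = cooper-sound (normalize (box u q)) holds
      z  , boxed      = normalize⁻ (box u q) z′ normalized
  in box⁻ u q z u≡n boxed

bounded∃-complete : ∀ u (q : QF (suc v)) {ρ n i} → ⟦ u ⟧ˡ ρ ≡ + n → 1 ℕ.≤ i → i ℕ.≤ n →
                    T (⟦ q ⟧ (+ i ∷ ρ)) → T (⟦ bounded∃ u q ⟧ ρ)
bounded∃-complete u q {i = i} u≡n 1≤i i≤n holds =
  cooper-complete (normalize (box u q)) (normalize-headAtMostOne (box u q)) 0<Ki
    (normalize⁺ (box u q) (+ i) (box⁺ u q u≡n 1≤i i≤n holds))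
  where
  K : ℕ
  K = scaleFactor (box u q)
  0<Ki : 0ℤ ℤ.< + K * + i
  0<Ki = subst (0ℤ ℤ.<_) (ℤ.pos-* K i)
    (ℤ.+<+ (ℕ.>-nonZero⁻¹ (K ℕ.* i) {{ℕ.m*n≢0 K i {{scaleFactor-nonZero (box u q)}} {{ℕ.>-nonZero 1≤i}}}}))

-- FO(+) on unary words

-- The length n of the word is the last variable.
env : ∀ {k} → (Fin k → ℕ) → ℕ → Vec ℤ (suc k)
env {zero}  ys n = + n ∷ []
env {suc k} ys n = + ys zero ∷ env (ys ∘ suc) n

lookup-env-inject₁ : ∀ {k} (ys : Fin k → ℕ) n j → lookup (env ys n) (inject₁ j) ≡ + ys j
lookup-env-inject₁ ys n zero    = refl
lookup-env-inject₁ ys n (suc j) = lookup-env-inject₁ (ys ∘ suc) n j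

lookup-env-fromℕ : ∀ {k} (ys : Fin k → ℕ) n → lookup (env ys n) (fromℕ k) ≡ + n
lookup-env-fromℕ {zero}  ys n = refl
lookup-env-fromℕ {suc k} ys n = lookup-env-fromℕ (ys ∘ suc) n

lengthˡ : LinForm (suc v)
lengthˡ = varˡ (fromℕ _)

termˡ : Term v → LinForm (suc v)
termˡ (var j) = varˡ (inject₁ j)
termˡ tmin    = constˡ 1ℤ
termˡ tmax    = lengthˡ

⟦lengthˡ⟧ : ∀ (ys : Fin v → ℕ) n → ⟦ lengthˡ ⟧ˡ (env ys n) ≡ + n
⟦lengthˡ⟧ ys n = trans (⟦varˡ⟧ (fromℕ _) (env ys n)) (lookup-env-fromℕ ys n)

⟦termˡ⟧ : ∀ (t : Term v) ys n → ⟦ termˡ t ⟧ˡ (env ys n) ≡ + evalTerm (replicate n 𝟘) ys t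
⟦termˡ⟧ (var j) ys n = trans (⟦varˡ⟧ (inject₁ j) (env ys n)) (lookup-env-inject₁ ys n j)
⟦termˡ⟧ tmin    ys n = ⟦constˡ⟧ 1ℤ (env ys n)
⟦termˡ⟧ tmax    ys n = trans (⟦lengthˡ⟧ ys n) (cong +_ (sym (length-replicate n)))

infix 4 _<ᶠ_ _≐ᶠ_
_<ᶠ_ : LinForm v → LinForm v → QF v
s <ᶠ t = atom (pos (t -ˡ s))

_≐ᶠ_ : LinForm v → LinForm v → QF v
s ≐ᶠ t = (s <ᶠ sucˡ t) ∧ᶜ (t <ᶠ sucˡ s)

⟦<ᶠ⟧ : ∀ (s t : LinForm v) {ρ x y} → ⟦ s ⟧ˡ ρ ≡ + x → ⟦ t ⟧ˡ ρ ≡ + y → ⟦ s <ᶠ t ⟧ ρ ≡ (x ℕ.<ᵇ y)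
⟦<ᶠ⟧ s t {ρ} {x} {y} s≡x t≡y rewrite ⟦-ˡ⟧ t s ρ | s≡x | t≡y | ℤ.m-n≡m⊖n y x =
  does-⇔ (0<⊖⇔ y x) (0ℤ ℤ.<? y ⊖ x) ((x ℕ.<ᵇ y) because ℕ.<ᵇ-reflects-< x y)

≡ᵇ-via-<ᵇ : ∀ x y → (x ℕ.≡ᵇ y) ≡ (x ℕ.<ᵇ suc y) ∧ (y ℕ.<ᵇ suc x)
≡ᵇ-via-<ᵇ zero    zero    = refl
≡ᵇ-via-<ᵇ zero    (suc y) = refl
≡ᵇ-via-<ᵇ (suc x) zero    = refl
≡ᵇ-via-<ᵇ (suc x) (suc y) = ≡ᵇ-via-<ᵇ x y

⟦≐ᶠ⟧ : ∀ (s t : LinForm v) {ρ x y} → ⟦ s ⟧ˡ ρ ≡ + x → ⟦ t ⟧ˡ ρ ≡ + y → ⟦ s ≐ᶠ t ⟧ ρ ≡ (x ℕ.≡ᵇ y)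
⟦≐ᶠ⟧ s t {ρ} {x} {y} s≡x t≡y = trans
  (cong₂ _∧_ (⟦<ᶠ⟧ s (sucˡ t) s≡x (⟦sucˡ⟧ t ρ t≡y)) (⟦<ᶠ⟧ t (sucˡ s) t≡y (⟦sucˡ⟧ s ρ s≡x)))
  (sym (≡ᵇ-via-<ᵇ x y))

isP₀-replicate : ∀ n i → isP₀ (replicate n 𝟘) i ≡ (0 ℕ.<ᵇ i) ∧ (i ℕ.<ᵇ suc n)
isP₀-replicate zero    zero          = refl
isP₀-replicate zero    (suc i)       = refl
isP₀-replicate (suc n) zero          = refl
isP₀-replicate (suc n) (suc zero)    = refl
isP₀-replicate (suc n) (suc (suc i)) = isP₀-replicate n (suc i)

translate : Formula v → QF (suc v)
translate (P₀ t)       = (constˡ 0ℤ <ᶠ termˡ t) ∧ᶜ (termˡ t <ᶠ sucˡ lengthˡ)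
translate (a ≺ b)      = termˡ a <ᶠ termˡ b
translate (a ≐ b)      = termˡ a ≐ᶠ termˡ b
translate (plus a b c) = termˡ a +ˡ termˡ b ≐ᶠ termˡ c
translate (¬' φ)       = ¬ᶠ translate φ
translate (φ ∧' ψ)     = translate φ ∧ᶜ translate ψ
translate (φ ∨' ψ)     = translate φ ∨ᶜ translate ψ
translate (∃' φ)       = bounded∃ lengthˡ (translate φ)
translate (∀' φ)       = ¬ᶠ bounded∃ lengthˡ (¬ᶠ translate φ)

T-any-positions : ∀ (f : ℕ → Bool) n → T (any f (positions n)) ⇔ (∃ λ i → 1 ℕ.≤ i × i ℕ.≤ n × T (f i))
T-any-positions f n = mk⇔ to from
  where
  to : T (any f (positions n)) → ∃ λ i → 1 ℕ.≤ i × i ℕ.≤ n × T (f i)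
  to holds with find (map⁻ (any⁻ f (positions n) holds))
  ... | i , i∈upTo , fi = suc i , ℕ.s≤s ℕ.z≤n , ∈-upTo⁻ i∈upTo , fi
  from : (∃ λ i → 1 ℕ.≤ i × i ℕ.≤ n × T (f i)) → T (any f (positions n))
  from (suc i , _ , i<n , fi) = any⁺ f (map⁺ (lose (∈-upTo⁺ i<n) fi))

any-positions≡bounded∃ : ∀ (q : QF (suc v)) u {ρ n} → ⟦ u ⟧ˡ ρ ≡ + n →
                         any (λ i → ⟦ q ⟧ (+ i ∷ ρ)) (positions n) ≡ ⟦ bounded∃ u q ⟧ ρ
any-positions≡bounded∃ q u {ρ} {n} u≡n = T-⇔⇒≡ (mk⇔
  (λ holds → let i , 1≤i , i≤n , qi = Equivalence.to (T-any-positions _ n) holds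
             in bounded∃-complete u q u≡n 1≤i i≤n qi)
  (Equivalence.from (T-any-positions _ n) ∘ bounded∃-sound u q u≡n))

all≡not-any-not : ∀ (f : A → Bool) xs → all f xs ≡ not (any (not ∘ f) xs)
all≡not-any-not f []       = refl
all≡not-any-not f (x ∷ xs) with f x
... | true  = all≡not-any-not f xs
... | false = refl

translate-correct : ∀ (φ : Formula v) n ys → sat (replicate n 𝟘) φ ys ≡ ⟦ translate φ ⟧ (env ys n)
translate-correct (P₀ t) n ys = trans (isP₀-replicate n _)
  (sym (cong₂ _∧_ (⟦<ᶠ⟧ (constˡ 0ℤ) (termˡ t) (⟦constˡ⟧ 0ℤ (env ys n)) (⟦termˡ⟧ t ys n))
                  (⟦<ᶠ⟧ (termˡ t) (sucˡ lengthˡ) (⟦termˡ⟧ t ys n)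
                        (⟦sucˡ⟧ lengthˡ (env ys n) (⟦lengthˡ⟧ ys n)))))
translate-correct (a ≺ b) n ys = sym (⟦<ᶠ⟧ (termˡ a) (termˡ b) (⟦termˡ⟧ a ys n) (⟦termˡ⟧ b ys n))
translate-correct (a ≐ b) n ys = sym (⟦≐ᶠ⟧ (termˡ a) (termˡ b) (⟦termˡ⟧ a ys n) (⟦termˡ⟧ b ys n))
translate-correct (plus a b c) n ys = sym (⟦≐ᶠ⟧ (termˡ a +ˡ termˡ b) (termˡ c)
  (trans (⟦+ˡ⟧ (termˡ a) (termˡ b) (env ys n)) (cong₂ _+_ (⟦termˡ⟧ a ys n) (⟦termˡ⟧ b ys n)))
  (⟦termˡ⟧ c ys n))
translate-correct (¬' φ) n ys =
  trans (cong not (translate-correct φ n ys)) (sym (⟦¬ᶠ⟧ (translate φ) (env ys n)))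
translate-correct (φ ∧' ψ) n ys = cong₂ _∧_ (translate-correct φ n ys) (translate-correct ψ n ys)
translate-correct (φ ∨' ψ) n ys = cong₂ _∨_ (translate-correct φ n ys) (translate-correct ψ n ys)
translate-correct (∃' φ) n ys rewrite length-replicate n {𝟘} = begin
  any (λ i → sat (replicate n 𝟘) φ (extend i ys)) (positions n)
    ≡⟨ cong or (map-cong (λ i → translate-correct φ n (extend i ys)) (positions n)) ⟩
  any (λ i → ⟦ translate φ ⟧ (+ i ∷ env ys n)) (positions n)
    ≡⟨ any-positions≡bounded∃ (translate φ) lengthˡ (⟦lengthˡ⟧ ys n) ⟩
  ⟦ bounded∃ lengthˡ (translate φ) ⟧ (env ys n) ∎
  where open ≡-Reasoning
translate-correct (∀' φ) n ys rewrite length-replicate n {𝟘} = begin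
  all (λ i → sat (replicate n 𝟘) φ (extend i ys)) (positions n)
    ≡⟨ all≡not-any-not _ (positions n) ⟩
  not (any (λ i → not (sat (replicate n 𝟘) φ (extend i ys))) (positions n))
    ≡⟨ cong (not ∘ or) (map-cong negated (positions n)) ⟩
  not (any (λ i → ⟦ ¬ᶠ translate φ ⟧ (+ i ∷ env ys n)) (positions n))
    ≡⟨ cong not (any-positions≡bounded∃ (¬ᶠ translate φ) lengthˡ (⟦lengthˡ⟧ ys n)) ⟩
  not (⟦ bounded∃ lengthˡ (¬ᶠ translate φ) ⟧ (env ys n))
    ≡⟨ sym (⟦¬ᶠ⟧ (bounded∃ lengthˡ (¬ᶠ translate φ)) (env ys n)) ⟩
  ⟦ ¬ᶠ bounded∃ lengthˡ (¬ᶠ translate φ) ⟧ (env ys n) ∎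
  where
  open ≡-Reasoning
  negated : ∀ i → not (sat (replicate n 𝟘) φ (extend i ys)) ≡ ⟦ ¬ᶠ translate φ ⟧ (+ i ∷ env ys n)
  negated i = trans (cong not (translate-correct φ n (extend i ys))) (sym (⟦¬ᶠ⟧ (translate φ) _))

-- Piecewise periodic strings

segment : (ℕ → A) → ℕ → ℕ → List A
segment f a zero      = []
segment f a (suc len) = f a ∷ segment f (suc a) len

length-segment : ∀ (f : ℕ → A) a len → length (segment f a len) ≡ len
length-segment f a zero      = refl
length-segment f a (suc len) = cong suc (length-segment f (suc a) len)

segment-++ : ∀ (f : ℕ → A) a m r → segment f a (m ℕ.+ r) ≡ segment f a m ++ segment f (a ℕ.+ m) r
segment-++ f a zero    r = cong (λ b → segment f b r) (sym (ℕ.+-identityʳ a))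
segment-++ f a (suc m) r = cong (f a ∷_)
  (trans (segment-++ f (suc a) m r) (cong (λ b → segment f (suc a) m ++ segment f b r) (sym (ℕ.+-suc a m))))

segment-cong : ∀ {f g : ℕ → A} a len → (∀ i → i ℕ.< len → f (a ℕ.+ i) ≡ g (a ℕ.+ i)) →
               segment f a len ≡ segment g a len
segment-cong a zero      eq = refl
segment-cong {f = f} {g} a (suc len) eq = cong₂ _∷_
  (subst (λ x → f x ≡ g x) (ℕ.+-identityʳ a) (eq 0 ℕ.z<s))
  (segment-cong (suc a) len λ i i<len → subst (λ x → f x ≡ g x) (ℕ.+-suc a i) (eq (suc i) (ℕ.s<s i<len)))

segment-suc : ∀ (f : ℕ → A) a len → segment f (suc a) len ≡ segment (f ∘ suc) a len
segment-suc f a zero      = refl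
segment-suc f a (suc len) = cong (f (suc a) ∷_) (segment-suc f (suc a) len)

map-positions : ∀ (f : ℕ → A) n → List.map f (positions n) ≡ segment f 1 n
map-positions f n = begin
  List.map f (List.map suc (upTo n))  ≡⟨ sym (map-∘ (upTo n)) ⟩
  List.map (f ∘ suc) (upTo n)         ≡⟨ map-upTo (f ∘ suc) n ⟩
  List.applyUpTo (f ∘ suc) n          ≡⟨ applyUpTo≡segment (f ∘ suc) n ⟩
  segment (f ∘ suc) 0 n               ≡⟨ sym (segment-suc f 0 n) ⟩
  segment f 1 n                       ∎
  where
  open ≡-Reasoning
  applyUpTo≡segment : ∀ (g : ℕ → A) n → List.applyUpTo g n ≡ segment g 0 n
  applyUpTo≡segment g zero    = refl
  applyUpTo≡segment g (suc n) =
    cong (g 0 ∷_) (trans (applyUpTo≡segment (g ∘ suc) n) (sym (segment-suc g 0 n)))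

segment-periodic : ∀ {f : ℕ → A} {M} → (∀ x → f (x ℕ.+ M) ≡ f x) →
                   ∀ a len → segment f (a ℕ.+ M) len ≡ segment f a len
segment-periodic per a zero      = refl
segment-periodic per a (suc len) = cong₂ _∷_ (per a) (segment-periodic per (suc a) len)

segment-pow : ∀ {f : ℕ → Bool} {M} → (∀ x → f (x ℕ.+ M) ≡ f x) → ∀ a e →
              segment f a (e ℕ.* M) ≡ pow (segment f a M) e
segment-pow per a zero    = refl
segment-pow {f = f} {M} per a (suc e) = begin
  segment f a (M ℕ.+ e ℕ.* M)                      ≡⟨ segment-++ f a M (e ℕ.* M) ⟩
  segment f a M ++ segment f (a ℕ.+ M) (e ℕ.* M)
    ≡⟨ cong (segment f a M ++_) (segment-periodic per a (e ℕ.* M)) ⟩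
  segment f a M ++ segment f a (e ℕ.* M)
    ≡⟨ cong (segment f a M ++_) (segment-pow per a e) ⟩
  segment f a M ++ pow (segment f a M) e ∎
  where open ≡-Reasoning

pieces : ℕ → ℕ
pieces zero    = 2
pieces (suc N) = pieces N ℕ.+ pieces N

1≤pieces : ∀ N → 1 ℕ.≤ pieces N
1≤pieces zero    = ℕ.s≤s ℕ.z≤n
1≤pieces (suc N) = ℕ.≤-trans (1≤pieces N) (ℕ.m≤m+n (pieces N) (pieces N))

Bounded-++ : ∀ {l l′ m s s′} → Bounded l m s → Bounded l′ m s′ → Bounded (l ℕ.+ l′) m (s ++ s′)
Bounded-++ {s = s} {s′} (us , es , us≤m , s≡) (us′ , es′ , us′≤m , s′≡) =
  us Vec.++ us′ , es Vec.++ es′ , AllV.++⁺ us≤m us′≤m , (begin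
    s ++ s′
      ≡⟨ cong₂ _++_ s≡ s′≡ ⟩
    concat (toList (zipWith pow us es)) ++ concat (toList (zipWith pow us′ es′))
      ≡⟨ concat-++ (toList (zipWith pow us es)) _ ⟩
    concat (toList (zipWith pow us es) ++ toList (zipWith pow us′ es′))
      ≡⟨ cong concat (sym (Vec.toList-++ (zipWith pow us es) _)) ⟩
    concat (toList (zipWith pow us es Vec.++ zipWith pow us′ es′))
      ≡⟨ cong (concat ∘ toList) (sym (Vec.zipWith-++ pow us us′ es es′)) ⟩
    concat (toList (zipWith pow (us Vec.++ us′) (es Vec.++ es′))) ∎)
  where open ≡-Reasoning

periodic-bounded : ∀ {f : ℕ → Bool} {M} {{_ : NonZero M}} → (∀ x → f (x ℕ.+ M) ≡ f x) →
                   ∀ a len → Bounded 2 M (segment f a len)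
periodic-bounded {f = f} {M} per a len =
  u ∷ w ∷ [] , e ∷ 1 ∷ [] , ℕ.≤-reflexive (length-segment f a M) AllV.∷ w≤M AllV.∷ AllV.[] , (begin
    segment f a len                            ≡⟨ cong (segment f a) len≡ ⟩
    segment f a (e ℕ.* M ℕ.+ r)                ≡⟨ segment-++ f a (e ℕ.* M) r ⟩
    segment f a (e ℕ.* M) ++ w                 ≡⟨ cong₂ _++_ (segment-pow per a e) (sym (++-identityʳ w)) ⟩
    pow u e ++ pow w 1                         ≡⟨ cong (pow u e ++_) (sym (++-identityʳ (pow w 1))) ⟩
    concat (toList (zipWith pow (u ∷ w ∷ []) (e ∷ 1 ∷ []))) ∎)
  where
  open ≡-Reasoning
  e r : ℕ
  e = len ℕ./ M
  r = len ℕ.% M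
  u w : List Bool
  u = segment f a M
  w = segment f (a ℕ.+ e ℕ.* M) r
  len≡ : len ≡ e ℕ.* M ℕ.+ r
  len≡ = trans (ℕ.m≡m%n+[m/n]*n len M) (ℕ.+-comm r (e ℕ.* M))
  w≤M : length w ℕ.≤ M
  w≤M = ℕ.≤-trans (ℕ.≤-reflexive (length-segment f _ r)) (ℕ.<⇒≤ (ℕ.m%n<n len M))

data Piecewise (Bd M : ℕ) : ℕ → (ℕ → Bool) → Set where
  periodic : ∀ {f} → (∀ x → f (x ℕ.+ M) ≡ f x) → Piecewise Bd M 0 f
  split    : ∀ {N f g h} c → Piecewise Bd M N g → Piecewise Bd M N h →
             (∀ x → x ℕ.< Bd → f x ≡ (if x ℕ.<ᵇ c then g x else h x)) → Piecewise Bd M (suc N) f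

module _ {Bd M : ℕ} (op : Bool → Bool → Bool) where

  combine-periodic : ∀ {N} {f g : ℕ → Bool} → (∀ x → f (x ℕ.+ M) ≡ f x) → Piecewise Bd M N g →
                     Piecewise Bd M N (λ x → op (f x) (g x))
  combine-periodic f-per (periodic g-per) = periodic (λ x → cong₂ op (f-per x) (g-per x))
  combine-periodic {f = f} f-per (split c pg ph g≡) =
    split c (combine-periodic f-per pg) (combine-periodic f-per ph)
    (λ x x<Bd → trans (cong (op (f x)) (g≡ x x<Bd)) (if-float (op (f x)) (x ℕ.<ᵇ c)))

  combine : ∀ {N N′} {f g : ℕ → Bool} → Piecewise Bd M N f → Piecewise Bd M N′ g →
            Piecewise Bd M (N ℕ.+ N′) (λ x → op (f x) (g x))
  combine (periodic f-per) pg = combine-periodic f-per pg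
  combine {g = g} (split c pf₁ pf₂ f≡) pg = split c (combine pf₁ pg) (combine pf₂ pg)
    (λ x x<Bd → trans (cong (λ b → op b (g x)) (f≡ x x<Bd)) (if-float (λ b → op b (g x)) (x ℕ.<ᵇ c)))

eventually-constant : ∀ (f : ℕ → Bool) b → (∀ {x y} → x ℕ.≤ y → f x ≡ b → f y ≡ b) →
                      ∀ Bd → ∃ λ c → ∀ x → x ℕ.< Bd → f x ≡ (if x ℕ.<ᵇ c then not b else b)
eventually-constant f b stable zero = 0 , λ _ ()
eventually-constant f b stable (suc Bd) with f 0 Bool.≟ b
... | yes f0≡b = 0 , λ x _ → stable ℕ.z≤n f0≡b
... | no f0≢b with eventually-constant (f ∘ suc) b (stable ∘ ℕ.s≤s) Bd
...   | c , f≡ = suc c , λ { zero _ → ¬-not f0≢b ; (suc x) x<Bd → f≡ x (ℕ.s<s⁻¹ x<Bd) }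

step-piecewise : ∀ {Bd M} (f : ℕ → Bool) b → (∀ {x y} → x ℕ.≤ y → f x ≡ b → f y ≡ b) → Piecewise Bd M 1 f
step-piecewise {Bd} f b stable with eventually-constant f b stable Bd
... | c , f≡ = split c (periodic (λ _ → refl)) (periodic (λ _ → refl)) f≡

increasing-piecewise : ∀ {Bd M} (f : ℕ → Bool) → (∀ {x y} → x ℕ.≤ y → T (f x) → T (f y)) → Piecewise Bd M 1 f
increasing-piecewise f mono =
  step-piecewise f true λ x≤y fx → Equivalence.to T-≡ (mono x≤y (Equivalence.from T-≡ fx))

decreasing-piecewise : ∀ {Bd M} (f : ℕ → Bool) → (∀ {x y} → x ℕ.≤ y → T (f y) → T (f x)) → Piecewise Bd M 1 f
decreasing-piecewise f anti = step-piecewise f false λ {x} {y} x≤y fx≡false → ¬-not λ fy≡true →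
  subst T fx≡false (anti x≤y (Equivalence.from T-≡ fy≡true))

weaken : ∀ {Bd M N f} → Piecewise Bd M N f → Piecewise Bd M (suc N) f
weaken p = split 0 p p (λ _ _ → refl)

dvd-shift : ∀ d (a b : ℤ) {M} → d ∣ℕ M → ∀ x →
            does (+ d ∣? a * + (x ℕ.+ M) + b) ≡ does (+ d ∣? a * + x + b)
dvd-shift d a b {M} d∣M x = trans (cong (λ z → does (+ d ∣? a * z + b)) (ℤ.pos-+ x M))
  (dvd-periodic d a b (∣ᵤ⇒∣ {+ d} {+ M} d∣M) (+ x))

atom-piecewise : ∀ (α : Atom (suc v)) ρ {Bd M} → divisor α ∣ℕ M → Piecewise Bd M 1 (λ x → ⟦ α ⟧ᵃ (+ x ∷ ρ))
atom-piecewise (pos (+ n x+ t)) ρ _ = increasing-piecewise _ λ x≤y holds →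
  ⇒does (0ℤ ℤ.<? _) (ℤ.<-≤-trans (does⇒ (0ℤ ℤ.<? _) holds)
    (ℤ.+-monoˡ-≤ (⟦ t ⟧ˡ ρ) (ℤ.*-monoˡ-≤-nonNeg (+ n) (ℤ.+≤+ x≤y))))
atom-piecewise (pos (-[1+ p ] x+ t)) ρ _ = decreasing-piecewise _ λ x≤y holds →
  ⇒does (0ℤ ℤ.<? _) (ℤ.<-≤-trans (does⇒ (0ℤ ℤ.<? _) holds)
    (ℤ.+-monoˡ-≤ (⟦ t ⟧ˡ ρ) (ℤ.*-monoˡ-≤-nonPos -[1+ p ] (ℤ.+≤+ x≤y))))
atom-piecewise (dvd d (a x+ t))  ρ d∣M = weaken (periodic (dvd-shift d a (⟦ t ⟧ˡ ρ) d∣M))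
atom-piecewise (ndvd d (a x+ t)) ρ d∣M = weaken (periodic (cong not ∘ dvd-shift d a (⟦ t ⟧ˡ ρ) d∣M))

size : BoolComb A → ℕ
size (atom _) = 1
size (p ∧ᶜ q) = size p ℕ.+ size q
size (p ∨ᶜ q) = size p ℕ.+ size q

evalᶜ-piecewise : ∀ {Bd M} (F : A → ℕ → Bool) q → (∀ {α} → α ∈ atoms q → Piecewise Bd M 1 (F α)) →
                  Piecewise Bd M (size q) (λ x → evalᶜ (λ α → F α x) q)
evalᶜ-piecewise F (atom α) pw = pw (here refl)
evalᶜ-piecewise F (p ∧ᶜ q) pw =
  combine _∧_ (evalᶜ-piecewise F p (pw ∘ ∈-++⁺ˡ)) (evalᶜ-piecewise F q (pw ∘ ∈-++⁺ʳ _))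
evalᶜ-piecewise F (p ∨ᶜ q) pw =
  combine _∨_ (evalᶜ-piecewise F p (pw ∘ ∈-++⁺ˡ)) (evalᶜ-piecewise F q (pw ∘ ∈-++⁺ʳ _))

QF-piecewise : ∀ (q : QF (suc v)) ρ Bd → Piecewise Bd (period q) (size q) (λ x → ⟦ q ⟧ (+ x ∷ ρ))
QF-piecewise q ρ Bd = evalᶜ-piecewise (λ α x → ⟦ α ⟧ᵃ (+ x ∷ ρ)) q λ {α} α∈q →
  atom-piecewise α ρ (divisor∣period q α∈q)

<∸⇒+< : ∀ a c {i} → i ℕ.< c ℕ.∸ a → a ℕ.+ i ℕ.< c
<∸⇒+< zero    c       i<c   = i<c
<∸⇒+< (suc a) (suc c) i<c-a = ℕ.s<s (<∸⇒+< a c i<c-a)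
<∸⇒+< (suc a) zero    ()

cut : ∀ a c len → ∃ λ k → ∃ λ r → k ℕ.+ r ≡ len ×
      (∀ i → i ℕ.< k → a ℕ.+ i ℕ.< c) × (∀ i → i ℕ.< r → c ℕ.≤ a ℕ.+ k ℕ.+ i)
cut a c len with c ℕ.∸ a ℕ.≤? len
... | yes c-a≤len = c ℕ.∸ a , len ℕ.∸ (c ℕ.∸ a) , ℕ.m+[n∸m]≡n c-a≤len , (λ i → <∸⇒+< a c) ,
                    (λ i _ → ℕ.≤-trans (ℕ.m≤n+m∸n c a) (ℕ.m≤m+n _ i))
... | no  c-a≰len = len , 0 , ℕ.+-identityʳ len ,
                    (λ i i<len → <∸⇒+< a c (ℕ.<-trans i<len (ℕ.≰⇒> c-a≰len))) , (λ i ())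

<ᵇ-true : ∀ {x c} → x ℕ.< c → (x ℕ.<ᵇ c) ≡ true
<ᵇ-true {x} {c} = dec-true ((x ℕ.<ᵇ c) because ℕ.<ᵇ-reflects-< x c)

<ᵇ-false : ∀ {x c} → c ℕ.≤ x → (x ℕ.<ᵇ c) ≡ false
<ᵇ-false {x} {c} c≤x = dec-false ((x ℕ.<ᵇ c) because ℕ.<ᵇ-reflects-< x c) (ℕ.≤⇒≯ c≤x)

piecewise-bounded : ∀ {Bd M N f} {{_ : NonZero M}} → Piecewise Bd M N f →
                    ∀ a len → a ℕ.+ len ℕ.≤ Bd → Bounded (pieces N) M (segment f a len)
piecewise-bounded (periodic f-per) a len _ = periodic-bounded f-per a len
piecewise-bounded {Bd} {f = f} (split {g = g} {h} c pg ph f≡) a len a+len≤Bd with cut a c len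
... | k , r , k+r≡len , below , above =
  subst (Bounded _ _) (sym segments)
    (Bounded-++ (piecewise-bounded pg a k a+k≤Bd) (piecewise-bounded ph (a ℕ.+ k) r a+k+r≤Bd))
  where
  open ≡-Reasoning
  a+k+r≤Bd : a ℕ.+ k ℕ.+ r ℕ.≤ Bd
  a+k+r≤Bd = subst (ℕ._≤ Bd) (trans (cong (a ℕ.+_) (sym k+r≡len)) (sym (ℕ.+-assoc a k r))) a+len≤Bd
  a+k≤Bd : a ℕ.+ k ℕ.≤ Bd
  a+k≤Bd = ℕ.≤-trans (ℕ.m≤m+n (a ℕ.+ k) r) a+k+r≤Bd
  f≡g : ∀ i → i ℕ.< k → f (a ℕ.+ i) ≡ g (a ℕ.+ i)
  f≡g i i<k = trans (f≡ _ (ℕ.<-≤-trans (ℕ.+-monoʳ-< a i<k) a+k≤Bd))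
                    (cong (if_then g (a ℕ.+ i) else h (a ℕ.+ i)) (<ᵇ-true (below i i<k)))
  f≡h : ∀ i → i ℕ.< r → f (a ℕ.+ k ℕ.+ i) ≡ h (a ℕ.+ k ℕ.+ i)
  f≡h i i<r = trans (f≡ _ (ℕ.<-≤-trans (ℕ.+-monoʳ-< (a ℕ.+ k) i<r) a+k+r≤Bd))
                    (cong (if_then g (a ℕ.+ k ℕ.+ i) else h (a ℕ.+ k ℕ.+ i)) (<ᵇ-false (above i i<r)))
  segments : segment f a len ≡ segment g a k ++ segment h (a ℕ.+ k) r
  segments = begin
    segment f a len                          ≡⟨ cong (segment f a) (sym k+r≡len) ⟩
    segment f a (k ℕ.+ r)                    ≡⟨ segment-++ f a k r ⟩
    segment f a k ++ segment f (a ℕ.+ k) r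
      ≡⟨ cong₂ _++_ (segment-cong a k f≡g) (segment-cong (a ℕ.+ k) r f≡h) ⟩
    segment g a k ++ segment h (a ℕ.+ k) r ∎

tString≡segment : ∀ {k} (φ : Formula (suc k)) n ys →
                  tString φ (replicate n 𝟘) ys ≡ segment (λ x → ⟦ translate φ ⟧ (+ x ∷ env ys n)) 1 n
tString≡segment φ n ys rewrite length-replicate n {𝟘} =
  trans (map-cong (λ i → translate-correct φ n (extend i ys)) (positions n)) (map-positions _ n)

lemma25 : (k : ℕ) (φ : Formula (suc k)) →
    ∃₂ λ (l m : ℕ) → 1 ≤ l × 1 ≤ m ×
      ((n : ℕ) (ys : Fin k → ℕ) → (∀ j → 1 ≤ ys j × ys j ≤ n) →
        Bounded l m (tString φ (replicate n 𝟘) ys))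
lemma25 k φ =
  pieces (size Q) , period Q , 1≤pieces (size Q) , ℕ.>-nonZero⁻¹ (period Q) {{period-nonZero Q}} ,
  λ n ys _ → subst (Bounded _ _) (sym (tString≡segment φ n ys))
    (piecewise-bounded {{period-nonZero Q}} (QF-piecewise Q (env ys n) (suc n)) 1 n ℕ.≤-refl)
  where
  Q : QF (suc (suc k))
  Q = translate φ
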